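{- Fix positive integers $k\leq n$, any $k\times n$ matrix $A$ over $\mathbb{F}_2$ and any non-empty $S\subseteq[k]$. There is a deterministic automaton $M_{A,S}$ over alphabet $[n]$ with $k+1$ states and at most $k\cdot n$ transitions whose language is $f_{A,S}^{ -1}(1)\subseteq[n]^k$.
   Context: All sums are in $\mathbb{F}_2$. For non-empty $S\subseteq[k]$ define $\phi_S:(\{0,1\}^k)^k\to\{0,1\}$ by $\phi_S(v_1,\ldots,v_k)=\prod_{i=1}^k\sum_{j\in S}v_{i,j}$, where $v_{i,j}$ is the $j$-th coordinate of $v_i$. For a $k\times n$ matrix $A$ over $\mathbb{F}_2$ with columns $v_1,\ldots,v_n\in\{0,1\}^k$, define $f_{A,S}:[n]^k\to\{0,1\}$ by $f_{A,S}(i_1,\ldots,i_k)=\phi_S(v_{i_1},\ldots,v_{i_k})$. A deterministic automaton is an automaton in which each state has at most one outgoing transition with each label; its language is the set of words labeling a path from the start state to an accepting state. -}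

module Defs where

open import Data.Nat using (ℕ; zero; suc; _+_)
open import Data.Bool using (Bool; true; false; _xor_; _∧_; if_then_else_)
open import Data.Fin using (Fin)
open import Data.Fin.Subset using (Subset; _∈_)
open import Data.Maybe using (Maybe; just; nothing; is-just; _>>=_)
open import Data.List using (List; []; _∷_; map; allFin)
open import Data.Nat.ListAction using (sum)
open import Data.Vec using (Vec; foldr)
open import Data.Product using (Σ; _×_)
open import Relation.Binary.PropositionalEquality using (_≡_)

-- 𝔽₂ is modelled by Bool (false = 0, true = 1, _xor_ = +, _∧_ = ·).

sumOver : {k : ℕ} → Subset k → (Fin k → Bool) → Bool
sumOver {k} S x = go (allFin k)
  where
  go : List (Fin k) → Bool
  go [] = false
  go (j ∷ js) = (Data.Vec.lookup S j ∧ x j) xor go js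

φ : {k m : ℕ} → Subset k → Vec (Fin k → Bool) m → Bool
φ S vs = foldr _ (λ v acc → sumOver S v ∧ acc) true vs

-- A k×n matrix over 𝔽₂: A r c is the entry in row r, column c.
Matrix : ℕ → ℕ → Set
Matrix k n = Fin k → Fin n → Bool

column : {k n : ℕ} → Matrix k n → Fin n → (Fin k → Bool)
column A c r = A r c

f : {k n : ℕ} → Matrix k n → Subset k → Vec (Fin n) k → Bool
f A S is = φ S (Data.Vec.map (column A) is)

-- Deterministic automaton over alphabet Fin n with state set Fin s:
-- each state has at most one outgoing transition per label (partial δ).
record DFA (n s : ℕ) : Set where
  field
    start  : Fin s
    δ      : Fin s → Fin n → Maybe (Fin s)
    accept : Fin s → Bool

open DFA public

run : {n s : ℕ} → DFA n s → Fin s → List (Fin n) → Maybe (Fin s)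
run M q [] = just q
run M q (a ∷ w) = δ M q a >>= λ q' → run M q' w

Accepts : {n s : ℕ} → DFA n s → List (Fin n) → Set
Accepts M w = Σ _ λ q → (run M (start M) w ≡ just q) × (accept M q ≡ true)

numTransitions : {n s : ℕ} → DFA n s → ℕ
numTransitions {n} {s} M =
  sum (map (λ q → sum (map (λ a → if is-just (δ M q a) then 1 else 0) (allFin n))) (allFin s))

-- f_{A,S}(i_1,…,i_k) = ∏_t g(i_t), where g(c) = Σ_{j∈S} A_{j,c} only depends on the
-- letter c: a word of length k lies in f_{A,S}⁻¹(1) iff all its letters are good.
-- The language "k good letters" is recognised by a chain 0 → 1 → ⋯ → k whose only
-- transitions are the good letters; state k is the only accepting state and has no
-- outgoing transitions, so there are at most k · n transitions.
module Submission where

open import Defs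
open import Data.Nat using (ℕ; zero; suc; _+_; _≤_; _*_; z≤n; s≤s)
open import Data.Nat.Properties using (≤-reflexive; ≤-trans; m≤n⇒m≤1+n; +-mono-≤)
open import Data.Nat.ListAction using (sum)
open import Data.Fin using (Fin; fromℕ) renaming (zero to fz; suc to fs)
open import Data.Fin.Subset using (Subset; Nonempty)
open import Data.Bool using (Bool; true; false; _∧_; if_then_else_)
open import Data.Maybe using (Maybe; just; nothing; is-just)
import Data.Maybe as Maybe
open import Data.List using (List; []; _∷_; length; map; allFin; tabulate)
open import Data.Bool.ListAction using (and)
open import Data.List.Properties using (map-cong; map-tabulate; tabulate-cong; length-tabulate)
open import Data.Vec using (Vec; toList)
import Data.Vec as Vec
open import Data.Vec.Properties using (length-toList)
open import Data.Product using (Σ; _×_; _,_; proj₁; proj₂)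
open import Function using (id; _∘_)
open import Function.Bundles using (_⇔_; mk⇔; Equivalence)
open import Relation.Binary.PropositionalEquality using (_≡_; refl; sym; trans; cong)

private
  variable
    n s s′ : ℕ

run-map : (M : DFA n s) (M′ : DFA n s′) (h : Fin s → Fin s′) →
          (∀ q a → δ M′ (h q) a ≡ Maybe.map h (δ M q a)) →
          ∀ q w → run M′ (h q) w ≡ Maybe.map h (run M q w)
run-map M M′ h δ-map q []      = refl
run-map M M′ h δ-map q (a ∷ w) rewrite δ-map q a with δ M q a
... | just q′ = run-map M M′ h δ-map q′ w
... | nothing = refl

sum-indicator≤length : {A : Set} (p : A → Bool) (xs : List A) →
                       sum (map (λ x → if p x then 1 else 0) xs) ≤ length xs
sum-indicator≤length p []       = z≤n
sum-indicator≤length p (x ∷ xs) with p x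
... | true  = s≤s (sum-indicator≤length p xs)
... | false = m≤n⇒m≤1+n (sum-indicator≤length p xs)

outDegree : DFA n s → Fin s → ℕ
outDegree {n} M q = sum (map (λ a → if is-just (δ M q a) then 1 else 0) (allFin n))

outDegree≤n : (M : DFA n s) (q : Fin s) → outDegree M q ≤ n
outDegree≤n {n} M q = ≤-trans (sum-indicator≤length (λ a → is-just (δ M q a)) (allFin n))
                              (≤-reflexive (length-tabulate _))

numTransitions≡sum-outDegree : (M : DFA n s) → numTransitions M ≡ sum (tabulate (outDegree M))
numTransitions≡sum-outDegree {s = s} M = cong sum (map-tabulate {n = s} id (outDegree M))

successor : (k : ℕ) → Fin (suc k) → Maybe (Fin (suc k))
successor zero    fz     = nothing
successor (suc k) fz     = just (fs fz)
successor (suc k) (fs q) = Maybe.map fs (successor k q)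

isLast : (k : ℕ) → Fin (suc k) → Bool
isLast zero    fz     = true
isLast (suc k) fz     = false
isLast (suc k) (fs q) = isLast k q

isLast-fromℕ : (k : ℕ) → isLast k (fromℕ k) ≡ true
isLast-fromℕ zero    = refl
isLast-fromℕ (suc k) = isLast-fromℕ k

module Chain (good : Fin n → Bool) where

  chain : (k : ℕ) → DFA n (suc k)
  chain k = record
    { start  = fz
    ; δ      = λ q a → if good a then successor k q else nothing
    ; accept = isLast k
    }

  δ-chain-fs : ∀ k q a → δ (chain (suc k)) (fs q) a ≡ Maybe.map fs (δ (chain k) q a)
  δ-chain-fs k q a with good a
  ... | true  = refl
  ... | false = refl

  run-chain-fs : ∀ k q w → run (chain (suc k)) (fs q) w ≡ Maybe.map fs (run (chain k) q w)
  run-chain-fs k = run-map (chain k) (chain (suc k)) fs (δ-chain-fs k)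

  accepts-chain⇒ : ∀ k w q → run (chain k) fz w ≡ just q → isLast k q ≡ true →
                   length w ≡ k × and (map good w) ≡ true
  accepts-chain⇒ zero    []      fz refl _ = refl , refl
  accepts-chain⇒ zero    (a ∷ w) q  e    _ with good a
  accepts-chain⇒ zero    (a ∷ w) q  ()   _ | true
  accepts-chain⇒ zero    (a ∷ w) q  ()   _ | false
  accepts-chain⇒ (suc k) []      .fz refl ()
  accepts-chain⇒ (suc k) (a ∷ w) q  e    last with good a
  accepts-chain⇒ (suc k) (a ∷ w) q  ()   last | false
  ... | true rewrite run-chain-fs k fz w with run (chain k) fz w in e′
  accepts-chain⇒ (suc k) (a ∷ w) .(fs q′) refl last | true | just q′
    with refl , all-good ← accepts-chain⇒ k w q′ e′ last = refl , all-good

  accepts-chain⇐ : ∀ k w → length w ≡ k → and (map good w) ≡ true →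
                   run (chain k) fz w ≡ just (fromℕ k)
  accepts-chain⇐ zero    []      refl _        = refl
  accepts-chain⇐ (suc k) (a ∷ w) refl all-good with good a
  accepts-chain⇐ (suc k) (a ∷ w) refl ()       | false
  ... | true = trans (run-chain-fs k fz w) (cong (Maybe.map fs) (accepts-chain⇐ k w refl all-good))

  accepts-chain⇔ : ∀ k w → Accepts (chain k) w ⇔ (length w ≡ k × and (map good w) ≡ true)
  accepts-chain⇔ k w = mk⇔
    (λ (q , e , last) → accepts-chain⇒ k w q e last)
    (λ (len , all-good) → fromℕ k , accepts-chain⇐ k w len all-good , isLast-fromℕ k)

  outDegree-chain-fs : ∀ k q → outDegree (chain (suc k)) (fs q) ≡ outDegree (chain k) q
  outDegree-chain-fs k q = cong sum (map-cong indicator-fs (allFin n))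
    where
    is-just-map : ∀ {m} (x : Maybe (Fin m)) → is-just (Maybe.map fs x) ≡ is-just x
    is-just-map (just _) = refl
    is-just-map nothing  = refl

    indicator-fs : ∀ a → (if is-just (δ (chain (suc k)) (fs q) a) then 1 else 0)
                       ≡ (if is-just (δ (chain k) q a) then 1 else 0)
    indicator-fs a = cong (λ b → if b then 1 else 0)
                          (trans (cong is-just (δ-chain-fs k q a)) (is-just-map _))

  outDegree-chain-zero : outDegree (chain zero) fz ≡ 0
  outDegree-chain-zero = no-transitions (allFin n)
    where
    no-transitions : ∀ as → sum (map (λ a → if is-just (δ (chain zero) fz a) then 1 else 0) as) ≡ 0
    no-transitions []       = refl
    no-transitions (a ∷ as) with good a
    ... | true  = no-transitions as
    ... | false = no-transitions as

  sum-outDegree-chain : ∀ k → sum (tabulate (outDegree (chain k))) ≤ k * n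
  sum-outDegree-chain zero    = ≤-reflexive (cong (_+ 0) outDegree-chain-zero)
  sum-outDegree-chain (suc k) =
    +-mono-≤ (outDegree≤n (chain (suc k)) fz)
             (≤-trans (≤-reflexive (cong sum (tabulate-cong (outDegree-chain-fs k))))
                      (sum-outDegree-chain k))

  numTransitions-chain : ∀ k → numTransitions (chain k) ≤ k * n
  numTransitions-chain k rewrite numTransitions≡sum-outDegree (chain k) = sum-outDegree-chain k

φ-map≡and-map : {k m : ℕ} (S : Subset k) (v : Fin n → Fin k → Bool) (x : Vec (Fin n) m) →
                φ S (Vec.map v x) ≡ and (map (sumOver S ∘ v) (toList x))
φ-map≡and-map S v Vec.[]      = refl
φ-map≡and-map S v (c Vec.∷ x) = cong (sumOver S (v c) ∧_) (φ-map≡and-map S v x)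

lemma6p3 : (k n : ℕ) → 1 ≤ k → k ≤ n → (A : Matrix k n) → (S : Subset k) → Nonempty S →
    Σ (DFA n (suc k)) λ M →
      (numTransitions M ≤ k * n)
      × ((w : List _) → Accepts M w → length w ≡ k)
      × ((x : Vec _ k) → Accepts M (toList x) ⇔ (f A S x ≡ true))
lemma6p3 k n _ _ A S _ = chain k , numTransitions-chain k , length-accepted , accepts⇔f
  where
  good : Fin n → Bool
  good = sumOver S ∘ column A

  open Chain good

  length-accepted : (w : List (Fin n)) → Accepts (chain k) w → length w ≡ k
  length-accepted w = proj₁ ∘ Equivalence.to (accepts-chain⇔ k w)

  accepts⇔f : (x : Vec (Fin n) k) → Accepts (chain k) (toList x) ⇔ (f A S x ≡ true)
  accepts⇔f x = mk⇔
    (λ acc → trans (φ-map≡and-map S (column A) x) (proj₂ (to acc)))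
    (λ fx → from (length-toList x , trans (sym (φ-map≡and-map S (column A) x)) fx))
    where open Equivalence (accepts-chain⇔ k (toList x))
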